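{- Let $G$ be a line grid graph obtained by taking an induced path (line) $B$ with endpoints $i$ and $j$ and attaching a line $A$ to an internal node $x$ of $B$ (so $G$ is a subdivision of the claw $K_{1,3}$ with center $x$). If $G$ is $12$-representable, then the length of $A$ is at most $2$, or the smaller of the distances from $x$ to $i$ and from $x$ to $j$ along $B$ is at most $2$.
   Context: The grid graph is the infinite graph on $\mathbb{Z}^2$ with vertices adjacent iff at Euclidean distance $1$. A line grid graph is a finite connected induced subgraph of the grid graph having an edge that lies in no $4$-cycle (square) of it. A line of length $k$ is an induced path with $k$ edges; attaching a line of length $k$ to a node $x$ means adding new vertices $u_1,\dots,u_k$ and edges $xu_1,u_1u_2,\dots,u_{k-1}u_k$. A labeled graph has distinct positive integers as vertices. A labeled graph $G=(V,E)$ is $12$-representable if there is a word $w$ whose set of letters is $V$ such that for all distinct $x,y\in V$: $xy\notin E$ iff some occurrence of $\min(x,y)$ precedes some occurrence of $\max(x,y)$ in $w$. An unlabeled graph is $12$-representable if some labeling of it is $12$-representable. -}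

module Defs where

open import Data.Nat using (ℕ; suc; _+_; _≤_; _<_)
open import Data.Integer using (ℤ; ∣_∣) renaming (_-_ to _-ℤ_)
open import Data.Fin using (Fin; toℕ)
open import Data.Product using (Σ; ∃; ∃-syntax; _×_; _,_)
open import Data.Sum using (_⊎_)
open import Data.List using (List; length; lookup)
open import Data.List.Membership.Propositional using (_∈_)
open import Relation.Nullary using (¬_)
open import Relation.Binary.PropositionalEquality using (_≡_; _≢_)
open import Relation.Binary.Construct.Closure.ReflexiveTransitive using (Star)
open import Function.Bundles using (_⇔_)
open import Function.Definitions using (Injective)

-- The grid graph on ℤ²: adjacent iff Euclidean distance 1,
-- i.e. |x₁ - x₂| + |y₁ - y₂| = 1 for integer points.
GridAdj : ℤ × ℤ → ℤ × ℤ → Set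
GridAdj (x₁ , y₁) (x₂ , y₂) = ∣ x₁ -ℤ x₂ ∣ + ∣ y₁ -ℤ y₂ ∣ ≡ 1

Finite : Set → Set
Finite V = ∃[ vs ] (∀ (v : V) → v ∈ vs)

IsInducedGridSubgraph : (V : Set) → (V → V → Set) → Set
IsInducedGridSubgraph V Adj =
  ∃[ f ] (Injective _≡_ _≡_ f × (∀ u v → Adj u v ⇔ GridAdj (f u) (f v)))

Connected : (V : Set) → (V → V → Set) → Set
Connected V Adj = ∀ (u v : V) → Star Adj u v

EdgeInSquare : {V : Set} → (V → V → Set) → V → V → Set
EdgeInSquare {V} Adj u v =
  ∃[ w ] ∃[ z ] (u ≢ v × u ≢ w × u ≢ z × v ≢ w × v ≢ z × w ≢ z
                 × Adj v w × Adj w z × Adj z u)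

IsLineGridGraph : (V : Set) → (V → V → Set) → Set
IsLineGridGraph V Adj =
  Finite V × IsInducedGridSubgraph V Adj × Connected V Adj
  × ∃[ u ] ∃[ v ] (Adj u v × ¬ EdgeInSquare Adj u v)

Precedes : {V : Set} → List V → V → V → Set
Precedes w p q =
  ∃[ i ] ∃[ j ] (toℕ i < toℕ j × lookup w i ≡ p × lookup w j ≡ q)

-- The labeled graph (vertices labelled by ℓ) is 12-represented by w.
-- Letters of w are vertices (identified with their labels via ℓ).
Represents12 : (V : Set) → (V → V → Set) → (V → ℕ) → List V → Set
Represents12 V Adj ℓ w =
  (∀ (v : V) → v ∈ w) ×
  (∀ (u v : V) → u ≢ v → ℓ u < ℓ v → ((¬ Adj u v) ⇔ Precedes w u v))

Is12Representable : (V : Set) → (V → V → Set) → Set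
Is12Representable V Adj =
  ∃[ ℓ ] (Injective _≡_ _≡_ ℓ × (∀ v → 1 ≤ ℓ v) × ∃[ w ] Represents12 V Adj ℓ w)

-- Subdivided claw: center x with three arms A, B₁, B₂ of lengths
-- a, b, c.  The line B is B₁ ∪ {x} ∪ B₂ with endpoints i (end of B₁)
-- and j (end of B₂); A is the line attached to x.
-- Vertex (arm r k) is at distance (toℕ k + 1) from the center.

data Arm : Set where
  armA armB₁ armB₂ : Arm

armLen : ℕ → ℕ → ℕ → Arm → ℕ
armLen a b c armA  = a
armLen a b c armB₁ = b
armLen a b c armB₂ = c

data ClawV (a b c : ℕ) : Set where
  center : ClawV a b c
  arm    : (r : Arm) → Fin (armLen a b c r) → ClawV a b c

data ClawEdge (a b c : ℕ) : ClawV a b c → ClawV a b c → Set where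
  first : (r : Arm) (k : Fin (armLen a b c r)) → toℕ k ≡ 0 →
          ClawEdge a b c center (arm r k)
  next  : (r : Arm) (k l : Fin (armLen a b c r)) → suc (toℕ k) ≡ toℕ l →
          ClawEdge a b c (arm r k) (arm r l)

ClawAdj : (a b c : ℕ) → ClawV a b c → ClawV a b c → Set
ClawAdj a b c u v = ClawEdge a b c u v ⊎ ClawEdge a b c v u

module Submission where

-- The claw subdivided three times on every arm is not 12-representable;
-- hence a 12-representable subdivided claw has an arm of length at most 2.
--
-- A 12-representation of a labelled graph only matters through the strict
-- order "smaller label" it induces on the vertices.  We first extract two
-- forbidden patterns for that order (Is12Order): the middle vertex of an
-- induced path on three vertices is never strictly between its neighbours,
-- and two edges without cross edges never have both lower ends below both
-- upper ends.  Both patterns are symmetric, so the reversed order is again a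
-- 12-order, and 12-orders pull back along induced embeddings.  The claw
-- with three arms of length 3 has no 12-order: reversing if necessary, the
-- first vertex of arm A, and then of every arm, lies below the centre; each
-- arm then rises and falls, and of the three second vertices two lie on the
-- same side of the centre, which produces a forbidden pattern either way.
-- Finally, if all arms have length at least 3, that claw is an induced
-- subgraph of the given one, so the given claw is not 12-representable.

open import Defs
open import Data.Nat using (ℕ; _≤_; _⊓_; suc; _<_)
open import Data.Sum using (_⊎_; inj₁; inj₂; swap)
import Data.Sum
open import Data.Nat.Properties using (<-cmp; <-trans; <-irrefl; ≤-trans; m⊓n≤m; m⊓n≤n; _≤?_; ≰⇒>)
open import Data.Fin using (Fin; toℕ; zero; suc; inject≤)
open import Data.Fin.Properties using (toℕ-injective; toℕ-inject≤)
open import Data.List using (List; lookup)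
open import Data.List.Relation.Unary.Any using (index)
open import Data.List.Relation.Unary.Any.Properties using (lookup-index)
open import Data.Product using (∃; _×_; _,_; proj₁; proj₂)
open import Data.Empty using (⊥; ⊥-elim)
open import Relation.Nullary using (¬_; yes; no)
open import Relation.Binary using (tri<; tri≈; tri>)
open import Relation.Binary.PropositionalEquality using (_≡_; _≢_; refl; sym; trans; cong; subst)
open import Function using (flip; _∘_)
open import Function.Bundles using (Equivalence)
open import Function.Definitions using (Injective)

record Is12Order {V : Set} (Adj : V → V → Set) (_≺_ : V → V → Set) : Set where
  field
    ≺-trans   : ∀ {u v w} → u ≺ v → v ≺ w → u ≺ w
    ≺-irrefl  : ∀ {u} → ¬ u ≺ u
    ≺-compare : ∀ {u v} → u ≢ v → u ≺ v ⊎ v ≺ u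
    no-monotone-path :
      ∀ {p q r} → Adj p q → Adj q r → ¬ Adj p r → p ≺ q → q ≺ r → ⊥
    no-crossed-matching :
      ∀ {p q r s} → Adj p q → Adj r s → ¬ Adj p s → ¬ Adj r q →
      p ≺ q → r ≺ s → p ≺ s → r ≺ q → ⊥

  ≺-asym : ∀ {u v} → u ≺ v → v ≺ u → ⊥
  ≺-asym u≺v v≺u = ≺-irrefl (≺-trans u≺v v≺u)

-- Two vertices are distinct if some vertex is adjacent to one but not the
-- other; this supplies the distinctness needed to compare vertices.
separated⇒distinct : ∀ {V : Set} (Adj : V → V → Set) {w u v} →
                     Adj w u → ¬ Adj w v → u ≢ v
separated⇒distinct Adj wu ¬wv u≡v = ¬wv (subst (Adj _) u≡v wu)

module Representation {V : Set} {Adj : V → V → Set} {ℓ : V → ℕ} {w : List V}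
       (ℓ-injective : Injective _≡_ _≡_ ℓ) (rep : Represents12 V Adj ℓ w) where

  AllBefore : V → V → Set
  AllBefore u v = ∀ i j → lookup w i ≡ u → lookup w j ≡ v → toℕ i < toℕ j

  occurrence : ∀ v → ∃ λ i → lookup w i ≡ v
  occurrence v = index (proj₁ rep v) , sym (lookup-index (proj₁ rep v))

  label-distinct : ∀ {u v} → ℓ u < ℓ v → u ≢ v
  label-distinct lt refl = <-irrefl refl lt

  edge⇒allBefore : ∀ {u v} → Adj u v → ℓ u < ℓ v → AllBefore v u
  edge⇒allBefore {u} {v} uv lt i j wi≡v wj≡u with <-cmp (toℕ i) (toℕ j)
  ... | tri< i<j _ _ = i<j
  ... | tri≈ _ i≡j _ = ⊥-elim (label-distinct lt
          (trans (sym wj≡u) (trans (cong (lookup w) (toℕ-injective (sym i≡j))) wi≡v)))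
  ... | tri> _ _ j<i = ⊥-elim (Equivalence.from (proj₂ rep u v (label-distinct lt) lt)
                                 (j , i , j<i , wj≡u , wi≡v) uv)

  nonEdge⇒precedes : ∀ {u v} → ¬ Adj u v → ℓ u < ℓ v → Precedes w u v
  nonEdge⇒precedes {u} {v} ¬uv lt =
    Equivalence.to (proj₂ rep u v (label-distinct lt) lt) ¬uv

  represented⇒12Order : Is12Order Adj (λ u v → ℓ u < ℓ v)
  represented⇒12Order = record
    { ≺-trans   = <-trans
    ; ≺-irrefl  = <-irrefl refl
    ; ≺-compare = compare
    ; no-monotone-path = monotone-path
    ; no-crossed-matching = crossed-matching
    }
    where
    compare : ∀ {u v} → u ≢ v → ℓ u < ℓ v ⊎ ℓ v < ℓ u
    compare {u} {v} u≢v with <-cmp (ℓ u) (ℓ v)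
    ... | tri< lt _ _ = inj₁ lt
    ... | tri≈ _ eq _ = ⊥-elim (u≢v (ℓ-injective eq))
    ... | tri> _ _ gt = inj₂ gt

    -- q occurs before p, r before q, yet p before r somewhere
    monotone-path : ∀ {p q r} → Adj p q → Adj q r → ¬ Adj p r →
                    ℓ p < ℓ q → ℓ q < ℓ r → ⊥
    monotone-path {q = q} pq qr ¬pr p<q q<r
      with occurrence q | nonEdge⇒precedes ¬pr (<-trans p<q q<r)
    ... | k , wk≡q | i , j , i<j , wi≡p , wj≡r =
      <-irrefl refl (<-trans (edge⇒allBefore pq p<q k i wk≡q wi≡p)
                    (<-trans i<j (edge⇒allBefore qr q<r j k wj≡r wk≡q)))

    -- q before p before s before r before q
    crossed-matching : ∀ {p q r s} → Adj p q → Adj r s → ¬ Adj p s → ¬ Adj r q →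
                       ℓ p < ℓ q → ℓ r < ℓ s → ℓ p < ℓ s → ℓ r < ℓ q → ⊥
    crossed-matching pq rs ¬ps ¬rq p<q r<s p<s r<q
      with nonEdge⇒precedes ¬ps p<s | nonEdge⇒precedes ¬rq r<q
    ... | i , j , i<j , wi≡p , wj≡s | k , m , k<m , wk≡r , wm≡q =
      <-irrefl refl (<-trans (edge⇒allBefore pq p<q m i wm≡q wi≡p)
                    (<-trans i<j (<-trans (edge⇒allBefore rs r<s j k wj≡s wk≡r) k<m)))

reverse-12Order : ∀ {V : Set} {Adj : V → V → Set} {_≺_ : V → V → Set} →
                  (∀ {u v} → Adj u v → Adj v u) →
                  Is12Order Adj _≺_ → Is12Order Adj (flip _≺_)
reverse-12Order {Adj = Adj} adj-sym O = record
  { ≺-trans   = λ u≻v v≻w → ≺-trans v≻w u≻v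
  ; ≺-irrefl  = ≺-irrefl
  ; ≺-compare = λ u≢v → swap (≺-compare u≢v)
  ; no-monotone-path = λ pq qr ¬pr q≺p r≺q →
      no-monotone-path (adj-sym qr) (adj-sym pq) (¬pr ∘ adj-sym) r≺q q≺p
  ; no-crossed-matching = λ pq rs ¬ps ¬rq q≺p s≺r s≺p q≺r →
      no-crossed-matching (adj-sym pq) (adj-sym rs) (¬rq ∘ adj-sym) (¬ps ∘ adj-sym)
                          q≺p s≺r q≺r s≺p
  }
  where open Is12Order O

record InducedEmbedding {U V : Set} (AdjU : U → U → Set) (AdjV : V → V → Set) : Set where
  field
    map       : U → V
    injective : ∀ {u v} → map u ≡ map v → u ≡ v
    preserves : ∀ {u v} → AdjU u v → AdjV (map u) (map v)
    reflects  : ∀ {u v} → AdjV (map u) (map v) → AdjU u v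

pullback-12Order : ∀ {U V : Set} {AdjU : U → U → Set} {AdjV : V → V → Set}
                   {_≺_ : V → V → Set} (e : InducedEmbedding AdjU AdjV) →
                   Is12Order AdjV _≺_ →
                   Is12Order AdjU (λ u v → InducedEmbedding.map e u ≺ InducedEmbedding.map e v)
pullback-12Order e O = record
  { ≺-trans   = ≺-trans
  ; ≺-irrefl  = ≺-irrefl
  ; ≺-compare = λ u≢v → ≺-compare (u≢v ∘ injective)
  ; no-monotone-path = λ pq qr ¬pr →
      no-monotone-path (preserves pq) (preserves qr) (¬pr ∘ reflects)
  ; no-crossed-matching = λ pq rs ¬ps ¬rq →
      no-crossed-matching (preserves pq) (preserves rs) (¬ps ∘ reflects) (¬rq ∘ reflects)
  }
  where open Is12Order O
        open InducedEmbedding e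

clawAdj-sym : ∀ {a b c} {u v : ClawV a b c} → ClawAdj a b c u v → ClawAdj a b c v u
clawAdj-sym (inj₁ e) = inj₂ e
clawAdj-sym (inj₂ e) = inj₁ e

arm-injective : ∀ {a b c r s} {k : Fin (armLen a b c r)} {l : Fin (armLen a b c s)} →
                arm r k ≡ arm s l → r ≡ s × toℕ k ≡ toℕ l
arm-injective refl = refl , refl

module ClawInclusion {a b c a′ b′ c′ : ℕ} (a≤a′ : a ≤ a′) (b≤b′ : b ≤ b′) (c≤c′ : c ≤ c′) where

  arm-shorter : ∀ r → armLen a b c r ≤ armLen a′ b′ c′ r
  arm-shorter armA  = a≤a′
  arm-shorter armB₁ = b≤b′
  arm-shorter armB₂ = c≤c′

  shift : ∀ {r} → Fin (armLen a b c r) → Fin (armLen a′ b′ c′ r)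
  shift {r} k = inject≤ k (arm-shorter r)

  depth-shift : ∀ {r} (k : Fin (armLen a b c r)) → toℕ (shift k) ≡ toℕ k
  depth-shift {r} k = toℕ-inject≤ k (arm-shorter r)

  include : ClawV a b c → ClawV a′ b′ c′
  include center    = center
  include (arm r k) = arm r (shift k)

  include-injective : ∀ {u v} → include u ≡ include v → u ≡ v
  include-injective {center}  {center}  _  = refl
  include-injective {center}  {arm _ _} ()
  include-injective {arm _ _} {center}  ()
  include-injective {arm r k} {arm s l} eq with arm-injective eq
  ... | refl , shift-k≡shift-l =
    cong (arm r) (toℕ-injective (trans (sym (depth-shift k)) (trans shift-k≡shift-l (depth-shift l))))

  include-edge : ∀ {u v} → ClawEdge a b c u v → ClawEdge a′ b′ c′ (include u) (include v)
  include-edge (first r k k≡0)  = first r (shift k) (trans (depth-shift k) k≡0)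
  include-edge (next r k l k+1≡l) =
    next r (shift k) (shift l) (trans (cong suc (depth-shift k)) (trans k+1≡l (sym (depth-shift l))))

  restrict-edge : ∀ {u v} → ClawEdge a′ b′ c′ (include u) (include v) → ClawEdge a b c u v
  restrict-edge {center}  {arm r k} (first .r _ k≡0) = first r k (trans (sym (depth-shift k)) k≡0)
  restrict-edge {arm r k} {arm .r l} (next .r _ _ k+1≡l) =
    next r k l (trans (cong suc (sym (depth-shift k))) (trans k+1≡l (depth-shift l)))

  claw-inclusion : InducedEmbedding (ClawAdj a b c) (ClawAdj a′ b′ c′)
  claw-inclusion = record
    { map       = include
    ; injective = include-injective
    ; preserves = Data.Sum.map include-edge include-edge
    ; reflects  = Data.Sum.map restrict-edge restrict-edge
    }

Claw₃ : Set
Claw₃ = ClawV 3 3 3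

Adj₃ : Claw₃ → Claw₃ → Set
Adj₃ = ClawAdj 3 3 3

leg : Arm → Fin 3 → Claw₃
leg armA  k = arm armA k
leg armB₁ k = arm armB₁ k
leg armB₂ k = arm armB₂ k

0F 1F 2F : Fin 3
0F = zero
1F = suc zero
2F = suc (suc zero)

module Claw₃Structure where

  centre-leg₀ : ∀ r → Adj₃ center (leg r 0F)
  centre-leg₀ armA  = inj₁ (first armA  0F refl)
  centre-leg₀ armB₁ = inj₁ (first armB₁ 0F refl)
  centre-leg₀ armB₂ = inj₁ (first armB₂ 0F refl)

  leg₀-leg₁ : ∀ r → Adj₃ (leg r 0F) (leg r 1F)
  leg₀-leg₁ armA  = inj₁ (next armA  0F 1F refl)
  leg₀-leg₁ armB₁ = inj₁ (next armB₁ 0F 1F refl)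
  leg₀-leg₁ armB₂ = inj₁ (next armB₂ 0F 1F refl)

  leg₁-leg₂ : ∀ r → Adj₃ (leg r 1F) (leg r 2F)
  leg₁-leg₂ armA  = inj₁ (next armA  1F 2F refl)
  leg₁-leg₂ armB₁ = inj₁ (next armB₁ 1F 2F refl)
  leg₁-leg₂ armB₂ = inj₁ (next armB₂ 1F 2F refl)

  ¬centre-leg : ∀ r k → toℕ k ≢ 0 → ¬ Adj₃ center (leg r k)
  ¬centre-leg armA  k k≢0 (inj₁ (first _ _ k≡0)) = k≢0 k≡0
  ¬centre-leg armB₁ k k≢0 (inj₁ (first _ _ k≡0)) = k≢0 k≡0
  ¬centre-leg armB₂ k k≢0 (inj₁ (first _ _ k≡0)) = k≢0 k≡0
  ¬centre-leg armA  k k≢0 (inj₂ ())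
  ¬centre-leg armB₁ k k≢0 (inj₂ ())
  ¬centre-leg armB₂ k k≢0 (inj₂ ())

  ¬leg₀-leg₂ : ∀ r → ¬ Adj₃ (leg r 0F) (leg r 2F)
  ¬leg₀-leg₂ armA  (inj₁ (next _ _ _ ()))
  ¬leg₀-leg₂ armA  (inj₂ (next _ _ _ ()))
  ¬leg₀-leg₂ armB₁ (inj₁ (next _ _ _ ()))
  ¬leg₀-leg₂ armB₁ (inj₂ (next _ _ _ ()))
  ¬leg₀-leg₂ armB₂ (inj₁ (next _ _ _ ()))
  ¬leg₀-leg₂ armB₂ (inj₂ (next _ _ _ ()))

  ¬cross : ∀ r s k l → r ≢ s → ¬ Adj₃ (leg r k) (leg s l)
  ¬cross armA  armA  k l r≢s _ = r≢s refl
  ¬cross armB₁ armB₁ k l r≢s _ = r≢s refl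
  ¬cross armB₂ armB₂ k l r≢s _ = r≢s refl
  ¬cross armA  armB₁ k l _ (inj₁ ())
  ¬cross armA  armB₁ k l _ (inj₂ ())
  ¬cross armA  armB₂ k l _ (inj₁ ())
  ¬cross armA  armB₂ k l _ (inj₂ ())
  ¬cross armB₁ armA  k l _ (inj₁ ())
  ¬cross armB₁ armA  k l _ (inj₂ ())
  ¬cross armB₁ armB₂ k l _ (inj₁ ())
  ¬cross armB₁ armB₂ k l _ (inj₂ ())
  ¬cross armB₂ armA  k l _ (inj₁ ())
  ¬cross armB₂ armA  k l _ (inj₂ ())
  ¬cross armB₂ armB₁ k l _ (inj₁ ())
  ¬cross armB₂ armB₁ k l _ (inj₂ ())

two-on-one-side : (P Q : Arm → Set) → (∀ r → P r ⊎ Q r) →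
                  (∀ r s → r ≢ s → P r → P s → ⊥) →
                  (∀ r s → r ≢ s → Q r → Q s → ⊥) → ⊥
two-on-one-side P Q side P-once Q-once with side armA | side armB₁ | side armB₂
... | inj₁ p | inj₁ q | _      = P-once _ _ (λ ()) p q
... | inj₂ p | inj₂ q | _      = Q-once _ _ (λ ()) p q
... | inj₁ p | inj₂ _ | inj₁ q = P-once _ _ (λ ()) p q
... | inj₂ p | inj₁ _ | inj₂ q = Q-once _ _ (λ ()) p q
... | inj₁ _ | inj₂ p | inj₂ q = Q-once _ _ (λ ()) p q
... | inj₂ _ | inj₁ p | inj₁ q = P-once _ _ (λ ()) p q

module NoClaw₃Order {_≺_ : Claw₃ → Claw₃ → Set} (O : Is12Order Adj₃ _≺_) where
  open Is12Order O
  open Claw₃Structure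

  1≢0 : toℕ 1F ≢ 0
  1≢0 ()

  2≢0 : toℕ 2F ≢ 0
  2≢0 ()

  -- The comparisons needed below, each between vertices separated by a
  -- neighbour of one of them.
  compare-leg₀-centre : ∀ r → leg r 0F ≺ center ⊎ center ≺ leg r 0F
  compare-leg₀-centre r = ≺-compare (separated⇒distinct Adj₃ (clawAdj-sym (leg₀-leg₁ r))
                                       (¬centre-leg r 1F 1≢0 ∘ clawAdj-sym))

  compare-centre-leg₁ : ∀ r → center ≺ leg r 1F ⊎ leg r 1F ≺ center
  compare-centre-leg₁ r = ≺-compare (separated⇒distinct Adj₃ (clawAdj-sym (leg₁-leg₂ r))
                                       (¬centre-leg r 2F 2≢0 ∘ clawAdj-sym) ∘ sym)

  compare-leg₀-leg₁ : ∀ r → leg r 0F ≺ leg r 1F ⊎ leg r 1F ≺ leg r 0F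
  compare-leg₀-leg₁ r = ≺-compare (separated⇒distinct Adj₃ (centre-leg₀ r) (¬centre-leg r 1F 1≢0))

  compare-leg₁-leg₂ : ∀ r → leg r 1F ≺ leg r 2F ⊎ leg r 2F ≺ leg r 1F
  compare-leg₁-leg₂ r = ≺-compare (separated⇒distinct Adj₃ (leg₀-leg₁ r) (¬leg₀-leg₂ r))

  compare-leg₀-leg₁′ : ∀ r s → leg r 0F ≺ leg s 1F ⊎ leg s 1F ≺ leg r 0F
  compare-leg₀-leg₁′ r s = ≺-compare (separated⇒distinct Adj₃ (centre-leg₀ r) (¬centre-leg s 1F 1≢0))

  -- if arm A starts below the centre, so does every other arm (else the
  -- centre would lie between its two neighbours A₀ and r₀)
  starts-below : leg armA 0F ≺ center → ∀ r → armA ≢ r → leg r 0F ≺ center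
  starts-below A₀≺x r A≢r with compare-leg₀-centre r
  ... | inj₁ r₀≺x = r₀≺x
  ... | inj₂ x≺r₀ = ⊥-elim (no-monotone-path (clawAdj-sym (centre-leg₀ armA)) (centre-leg₀ r)
                              (¬cross armA r 0F 0F A≢r) A₀≺x x≺r₀)

  all-start-below : leg armA 0F ≺ center → ∀ r → leg r 0F ≺ center
  all-start-below A₀≺x armA  = A₀≺x
  all-start-below A₀≺x armB₁ = starts-below A₀≺x armB₁ (λ ())
  all-start-below A₀≺x armB₂ = starts-below A₀≺x armB₂ (λ ())

  module AllBelow (below : ∀ r → leg r 0F ≺ center) where

    rising : ∀ r → leg r 0F ≺ leg r 1F
    rising r with compare-leg₀-leg₁ r
    ... | inj₁ r₀≺r₁ = r₀≺r₁
    ... | inj₂ r₁≺r₀ = ⊥-elim (no-monotone-path (clawAdj-sym (leg₀-leg₁ r)) (clawAdj-sym (centre-leg₀ r))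
                                (¬centre-leg r 1F 1≢0 ∘ clawAdj-sym) r₁≺r₀ (below r))

    falling : ∀ r → leg r 2F ≺ leg r 1F
    falling r with compare-leg₁-leg₂ r
    ... | inj₂ r₂≺r₁ = r₂≺r₁
    ... | inj₁ r₁≺r₂ = ⊥-elim (no-monotone-path (leg₀-leg₁ r) (leg₁-leg₂ r) (¬leg₀-leg₂ r)
                                (rising r) r₁≺r₂)

    -- two arms whose second vertices lie above the centre give crossed edges
    -- r₀r₁, s₀s₁
    not-two-above : ∀ r s → r ≢ s → center ≺ leg r 1F → center ≺ leg s 1F → ⊥
    not-two-above r s r≢s x≺r₁ x≺s₁ =
      no-crossed-matching (leg₀-leg₁ r) (leg₀-leg₁ s)
        (¬cross r s 0F 1F r≢s) (¬cross s r 0F 1F (r≢s ∘ sym))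
        (rising r) (rising s) (≺-trans (below r) x≺s₁) (≺-trans (below s) x≺r₁)

    -- s₁ below the centre and above r₀ gives crossed edges r₀x, s₂s₁
    not-between : ∀ r s → r ≢ s → leg s 1F ≺ center → leg r 0F ≺ leg s 1F → ⊥
    not-between r s r≢s s₁≺x r₀≺s₁ =
      no-crossed-matching (clawAdj-sym (centre-leg₀ r)) (clawAdj-sym (leg₁-leg₂ s))
        (¬cross r s 0F 1F r≢s) (¬centre-leg s 2F 2≢0 ∘ clawAdj-sym)
        (below r) (falling s) r₀≺s₁ (≺-trans (falling s) s₁≺x)

    -- two arms whose second vertices lie below the centre: either one of
    -- them lies between the centre and the other arm's first vertex, or
    -- r₀ ≺ r₁ ≺ s₀ ≺ s₁ ≺ r₀ is a cycle
    not-two-below : ∀ r s → r ≢ s → leg r 1F ≺ center → leg s 1F ≺ center → ⊥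
    not-two-below r s r≢s r₁≺x s₁≺x with compare-leg₀-leg₁′ r s
    ... | inj₁ r₀≺s₁ = not-between r s r≢s s₁≺x r₀≺s₁
    ... | inj₂ s₁≺r₀ with compare-leg₀-leg₁′ s r
    ...   | inj₁ s₀≺r₁ = not-between s r (r≢s ∘ sym) r₁≺x s₀≺r₁
    ...   | inj₂ r₁≺s₀ = ≺-asym s₁≺r₀ (≺-trans (rising r) (≺-trans r₁≺s₀ (rising s)))

  no-order-with-A₀-below : leg armA 0F ≺ center → ⊥
  no-order-with-A₀-below A₀≺x =
    two-on-one-side _ _ compare-centre-leg₁ not-two-above not-two-below
    where open AllBelow (all-start-below A₀≺x)

-- Claw₃ has no 12-order: reverse the order if arm A starts above the centre.
claw₃-no-12Order : ∀ {_≺_ : Claw₃ → Claw₃ → Set} → Is12Order Adj₃ _≺_ → ⊥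
claw₃-no-12Order O with NoClaw₃Order.compare-leg₀-centre O armA
... | inj₁ A₀≺x = NoClaw₃Order.no-order-with-A₀-below O A₀≺x
... | inj₂ x≺A₀ = NoClaw₃Order.no-order-with-A₀-below (reverse-12Order clawAdj-sym O) x≺A₀

long-claw-not-12-representable : ∀ {a b c} → 3 ≤ a → 3 ≤ b → 3 ≤ c →
                                 ¬ Is12Representable (ClawV a b c) (ClawAdj a b c)
long-claw-not-12-representable 3≤a 3≤b 3≤c (ℓ , ℓ-injective , _ , w , rep) =
  claw₃-no-12Order (pullback-12Order (ClawInclusion.claw-inclusion 3≤a 3≤b 3≤c)
                                     (Representation.represented⇒12Order ℓ-injective rep))

proposition27 : (a b c : ℕ) → 1 ≤ a → 1 ≤ b → 1 ≤ c →
    IsLineGridGraph (ClawV a b c) (ClawAdj a b c) →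
    Is12Representable (ClawV a b c) (ClawAdj a b c) →
    a ≤ 2 ⊎ b ⊓ c ≤ 2
proposition27 a b c _ _ _ _ representable with a ≤? 2 | b ⊓ c ≤? 2
... | yes a≤2 | _        = inj₁ a≤2
... | no _    | yes m≤2  = inj₂ m≤2
... | no a≰2  | no m≰2   =
  ⊥-elim (long-claw-not-12-representable (≰⇒> a≰2) (≤-trans 2<m (m⊓n≤m b c))
                                        (≤-trans 2<m (m⊓n≤n b c)) representable)
  where
  2<m : 2 < b ⊓ c
  2<m = ≰⇒> m≰2
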